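{- Let $s\ge 2$ and let $(G,W,k)$ be an instance of Seeded $s$-Club in which $W$ is a clique in $G$, $|W|<k$, and every vertex of $G$ has distance at most $s$ to every vertex of $W$. If $|N_s(W)|\ge k^{2|W|+1}$, then $(G,W,k)$ is a yes-instance.
   Context: Seeded $s$-Club: given an undirected graph $G=(V,E)$, a set $W\subseteq V$ and an integer $k\ge 1$, decide whether $G$ contains a vertex set $S$ with $W\subseteq S$, $|S|\ge k$, and $G[S]$ of diameter at most $s$. For $W\subseteq V$, $N_s(W)$ denotes the set of vertices $u$ with $\min_{w\in W}\mathrm{dist}_G(u,w)=s$. -}

module Defs where

open import Data.Nat using (ℕ; zero; suc; _≤_; pred)
open import Data.Bool using (Bool; true; false)
open import Data.Fin using (Fin)
open import Data.Fin.Subset using (Subset; _∈_; _∉_; _⊆_; ∣_∣; ⊤)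
open import Data.Product using (Σ; ∃; _×_; _,_)
open import Relation.Binary.PropositionalEquality using (_≡_; _≢_)
open import Relation.Nullary using (¬_)

record Graph (n : ℕ) : Set where
  field
    adj   : Fin n → Fin n → Bool
    sym   : ∀ u v → adj u v ≡ adj v u
    irref : ∀ u → adj u u ≡ false

open Graph public

data WalkIn {n : ℕ} (G : Graph n) (S : Subset n) : Fin n → Fin n → ℕ → Set where
  here : ∀ {u} → u ∈ S → WalkIn G S u u zero
  step : ∀ {u v w ℓ} → u ∈ S → adj G u v ≡ true → WalkIn G S v w ℓ → WalkIn G S u w (suc ℓ)

DistLeIn : {n : ℕ} → Graph n → Subset n → Fin n → Fin n → ℕ → Set
DistLeIn G S u v d = ∃ λ ℓ → ℓ ≤ d × WalkIn G S u v ℓ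

DistLe : {n : ℕ} → Graph n → Fin n → Fin n → ℕ → Set
DistLe {n} G u v d = ∃ λ ℓ → ℓ ≤ d × WalkIn G ⊤ u v ℓ

DiamLe : {n : ℕ} → Graph n → Subset n → ℕ → Set
DiamLe G S s = ∀ u v → u ∈ S → v ∈ S → DistLeIn G S u v s

IsClique : {n : ℕ} → Graph n → Subset n → Set
IsClique G W = ∀ u v → u ∈ W → v ∈ W → u ≢ v → adj G u v ≡ true

-- u ∈ N_s(W): min_{w ∈ W} dist_G(u,w) = s  (for s ≥ 1),
-- i.e. some w ∈ W is at distance ≤ s, and no w ∈ W is at distance ≤ s-1.
InNs : {n : ℕ} → Graph n → Subset n → ℕ → Fin n → Set
InNs G W s u =
  (∃ λ w → w ∈ W × DistLe G u w s) × (∀ w → w ∈ W → ¬ DistLe G u w (pred s))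

SeededClubYes : {n : ℕ} → Graph n → Subset n → ℕ → ℕ → Set
SeededClubYes {n} G W k s = ∃ λ (S : Subset n) → W ⊆ S × k ≤ ∣ S ∣ × DiamLe G S s

-- If no s-club of size k contains the clique W, then every vertex set of diameter at most s
-- containing W has fewer than k vertices. Such sets arise as hulls: given a set U and, for each
-- seed w, a centre c(w) within distance h of w and within distance j of all of U (j + j ≤ s and
-- j + h ≤ s), the vertices on short walks from U and from the seeds to the centres form a set of
-- diameter at most s, so |U| < k. Take j = ⌊s/2⌋ and h = ⌈s/2⌉. Each seed has fewer than k²
-- candidate centres (the vertices within distance h), and splitting a walk of length at most s
-- from a vertex u to a seed w into parts of length at most j and h yields a candidate within
-- distance j of u. Fixing the centres one seed at a time thus covers the vertex set by fewer
-- than (k²)^|W| sets of fewer than k vertices each.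
-- Whether a club exists is decidable, which makes the contradiction argument constructive.
module Submission where

open import Defs
open import Data.Nat using (ℕ; _≤_; _<_; _^_; _*_; _+_)
open import Data.Fin.Subset using (Subset; _∈_; _⊆_; ∣_∣)
open import Data.Product using (Σ; _×_)
open import Data.Nat using (zero; suc; _∸_; s≤s; z≤n; _≤?_; NonZero; >-nonZero; >-nonZero⁻¹)
open import Data.Nat.Properties hiding (_≟_)
open import Data.Nat.Tactic.RingSolver using (solve-∀)
open import Data.Fin using (Fin; zero; suc; _≟_)
open import Data.Fin.Properties using (any?; all?)
open import Data.Fin.Subset using (⊤; ⊥; _∪_; _∩_; inside; outside; Empty)
open import Data.Fin.Subset.Properties
  using (∈⊤; _∈?_; _⊆?_; p⊆q⇒∣p∣≤∣q∣; ∣⊥∣≡0; Empty-unique; nonempty?; anySubset?;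
         x∈p∪q⁺; x∈p∩q⁺; x∈p∩q⁻; p∩q⊆p)
open import Data.Product using (∃; ∃₂; _,_; proj₁; proj₂)
open import Data.Sum using (inj₁; inj₂)
open import Data.Bool using (true)
open import Data.Bool.Properties using () renaming (_≟_ to _≟ᵇ_)
open import Data.List using (List; []; _∷_; length; map)
open import Data.List.Relation.Unary.All using (All; []; _∷_)
import Data.List.Relation.Unary.All as All
open import Data.List.Relation.Unary.All.Properties using (map⁺)
open import Data.List.Membership.Propositional using () renaming (_∈_ to _∈ₗ_; _∉_ to _∉ₗ_)
open import Data.List.Membership.Propositional.Properties using (∈-map⁺)
open import Data.List.Relation.Unary.Any using (here; there)
open import Data.List.Properties using (length-map)
open import Data.Vec using ([]; _∷_; here; there)
open import Function using (_∘_; id; const)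
open import Data.Vec.Functional using (updateAt)
open import Data.Vec.Functional.Properties using (updateAt-updates; updateAt-minimal)
open import Level using (0ℓ)
open import Relation.Binary.PropositionalEquality
  using (_≡_; refl; trans; cong; subst) renaming (sym to ≡-sym)
open import Relation.Nullary using (¬_; Dec; yes; no; does; contradiction)
open import Relation.Nullary.Decidable using (map′; _×-dec_; _⊎-dec_; _→-dec_)
open import Relation.Unary using (Pred; Decidable) renaming (_⊆_ to _⊆ᵤ_)

select : ∀ {n} {P : Pred (Fin n) 0ℓ} → Decidable P → Subset n
select {zero}  P? = []
select {suc n} P? = does (P? zero) ∷ select (P? ∘ suc)

∈-select⁺ : ∀ {n} {P : Pred (Fin n) 0ℓ} (P? : Decidable P) {x} → P x → x ∈ select P?
∈-select⁺ P? {zero} p with P? zero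
... | yes _  = here
... | no ¬p = contradiction p ¬p
∈-select⁺ P? {suc x} p = there (∈-select⁺ (P? ∘ suc) p)

∈-select⁻ : ∀ {n} {P : Pred (Fin n) 0ℓ} (P? : Decidable P) {x} → x ∈ select P? → P x
∈-select⁻ P? {zero} x∈ with P? zero
∈-select⁻ P? {zero} here | yes p = p
∈-select⁻ P? {suc x} (there x∈) = ∈-select⁻ (P? ∘ suc) x∈

Empty⇒∣p∣≡0 : ∀ {n} {p : Subset n} → Empty p → ∣ p ∣ ≡ 0
Empty⇒∣p∣≡0 {n} p-empty = trans (cong ∣_∣ (Empty-unique p-empty)) (∣⊥∣≡0 n)

∣p∪q∣≤∣p∣+∣q∣ : ∀ {n} (p q : Subset n) → ∣ p ∪ q ∣ ≤ ∣ p ∣ + ∣ q ∣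
∣p∪q∣≤∣p∣+∣q∣ []            []            = z≤n
∣p∪q∣≤∣p∣+∣q∣ (inside  ∷ p) (inside  ∷ q) =
  s≤s (≤-trans (∣p∪q∣≤∣p∣+∣q∣ p q) (+-monoʳ-≤ ∣ p ∣ (n≤1+n ∣ q ∣)))
∣p∪q∣≤∣p∣+∣q∣ (inside  ∷ p) (outside ∷ q) = s≤s (∣p∪q∣≤∣p∣+∣q∣ p q)
∣p∪q∣≤∣p∣+∣q∣ (outside ∷ p) (inside  ∷ q) =
  ≤-trans (s≤s (∣p∪q∣≤∣p∣+∣q∣ p q)) (≤-reflexive (≡-sym (+-suc ∣ p ∣ ∣ q ∣)))
∣p∪q∣≤∣p∣+∣q∣ (outside ∷ p) (outside ∷ q) = ∣p∪q∣≤∣p∣+∣q∣ p q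

⋃ₛ : ∀ {m n} → Subset m → (Fin m → Subset n) → Subset n
⋃ₛ []            A = ⊥
⋃ₛ (inside  ∷ C) A = A zero ∪ ⋃ₛ C (A ∘ suc)
⋃ₛ (outside ∷ C) A = ⋃ₛ C (A ∘ suc)

∈-⋃ₛ⁺ : ∀ {m n} (C : Subset m) (A : Fin m → Subset n) {y x} → y ∈ C → x ∈ A y → x ∈ ⋃ₛ C A
∈-⋃ₛ⁺ (inside  ∷ C) A here       x∈A = x∈p∪q⁺ (inj₁ x∈A)
∈-⋃ₛ⁺ (inside  ∷ C) A (there y∈C) x∈A = x∈p∪q⁺ (inj₂ (∈-⋃ₛ⁺ C (A ∘ suc) y∈C x∈A))
∈-⋃ₛ⁺ (outside ∷ C) A (there y∈C) x∈A = ∈-⋃ₛ⁺ C (A ∘ suc) y∈C x∈A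

∣⋃ₛ∣≤ : ∀ {m n} (C : Subset m) (A : Fin m → Subset n) {M} →
        (∀ {y} → y ∈ C → ∣ A y ∣ ≤ M) → ∣ ⋃ₛ C A ∣ ≤ ∣ C ∣ * M
∣⋃ₛ∣≤ {n = n} []            A A≤M = ≤-reflexive (∣⊥∣≡0 n)
∣⋃ₛ∣≤ (inside  ∷ C) A A≤M =
  ≤-trans (∣p∪q∣≤∣p∣+∣q∣ (A zero) _) (+-mono-≤ (A≤M here) (∣⋃ₛ∣≤ C (A ∘ suc) (A≤M ∘ there)))
∣⋃ₛ∣≤ (outside ∷ C) A A≤M = ∣⋃ₛ∣≤ C (A ∘ suc) (A≤M ∘ there)

∣⋃ₛ∣< : ∀ {m n} (C : Subset m) (A : Fin m → Subset n) {p q} .{{_ : NonZero q}} →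
        ∣ C ∣ < p → (∀ {y} → y ∈ C → ∣ A y ∣ < q) → ∣ ⋃ₛ C A ∣ < p * q
∣⋃ₛ∣< C A C<p A<q =
  ≤-<-trans (∣⋃ₛ∣≤ C A (suc[m]≤n⇒m≤pred[n] ∘ A<q)) (*-mono-< C<p (m≤pred[n]⇒suc[m]≤n ≤-refl))

elements : ∀ {n} → Subset n → List (Fin n)
elements []            = []
elements (inside  ∷ p) = zero ∷ map suc (elements p)
elements (outside ∷ p) = map suc (elements p)

length-elements : ∀ {n} (p : Subset n) → length (elements p) ≡ ∣ p ∣
length-elements []            = refl
length-elements (inside  ∷ p) = cong suc (trans (length-map suc (elements p)) (length-elements p))
length-elements (outside ∷ p) = trans (length-map suc (elements p)) (length-elements p)

∈-elements⁺ : ∀ {n} {p : Subset n} {x} → x ∈ p → x ∈ₗ elements p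
∈-elements⁺ {p = inside  ∷ p} here        = here refl
∈-elements⁺ {p = inside  ∷ p} (there x∈p) = there (∈-map⁺ suc (∈-elements⁺ x∈p))
∈-elements⁺ {p = outside ∷ p} (there x∈p) = ∈-map⁺ suc (∈-elements⁺ x∈p)

elements⊆ : ∀ {n} (p : Subset n) → All (_∈ p) (elements p)
elements⊆ []            = []
elements⊆ (inside  ∷ p) = here ∷ map⁺ (All.map there (elements⊆ p))
elements⊆ (outside ∷ p) = map⁺ (All.map there (elements⊆ p))

module Walks {n : ℕ} (G : Graph n) where

  private variable
    S : Subset n
    x y z : Fin n
    a b d ℓ : ℕ

  infixr 5 _++ʷ_ _⊙_
  infix 6 _˘

  _++ʷ_ : WalkIn G S x y a → WalkIn G S y z b → WalkIn G S x z (a + b)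
  here _       ++ʷ q = q
  step x∈S e p ++ʷ q = step x∈S e (p ++ʷ q)

  snocʷ : WalkIn G S x y a → z ∈ S → adj G y z ≡ true → WalkIn G S x z (suc a)
  snocʷ (here x∈S)     z∈S e = step x∈S e (here z∈S)
  snocʷ (step x∈S e′ p) z∈S e = step x∈S e′ (snocʷ p z∈S e)

  reverseʷ : WalkIn G S x y a → WalkIn G S y x a
  reverseʷ (here x∈S)             = here x∈S
  reverseʷ (step {u} {v} u∈S e p) = snocʷ (reverseʷ p) u∈S (trans (sym G v u) e)

  _⊙_ : DistLeIn G S x y a → DistLeIn G S y z b → DistLeIn G S x z (a + b)
  (l , l≤a , p) ⊙ (l′ , l′≤b , q) = l + l′ , +-mono-≤ l≤a l′≤b , p ++ʷ q

  _˘ : DistLeIn G S x y a → DistLeIn G S y x a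
  (l , l≤a , p) ˘ = l , l≤a , reverseʷ p

  DistLeIn-weaken : a ≤ b → DistLeIn G S x y a → DistLeIn G S x y b
  DistLeIn-weaken a≤b (l , l≤a , p) = l , ≤-trans l≤a a≤b , p

  DistLe-refl : DistLe G x x a
  DistLe-refl = 0 , z≤n , here ∈⊤

  DistLe-step : adj G x y ≡ true → DistLe G y z a → DistLe G x z (suc a)
  DistLe-step e (l , l≤a , p) = suc l , s≤s l≤a , step ∈⊤ e p

  DistLe-split : ∀ a b → DistLe G x y (a + b) → ∃ λ z → DistLe G x z a × DistLe G z y b
  DistLe-split zero    b x⇝y                           = _ , DistLe-refl , x⇝y
  DistLe-split (suc a) b (zero  , _        , here _)   = _ , DistLe-refl , DistLe-refl
  DistLe-split (suc a) b (suc l , s≤s l≤ab , step _ e p) with DistLe-split a b (l , l≤ab , p)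
  ... | z , v⇝z , z⇝y = z , DistLe-step e v⇝z , z⇝y

  DistLeIn-shorter : ∀ s {X Y} → DistLeIn G S x y X → DistLeIn G S x y Y → X + Y ≤ suc (s + s) →
                     DistLeIn G S x y s
  DistLeIn-shorter s {X} {Y} x⇝y x⇝y′ X+Y≤ with X ≤? s
  ... | yes X≤s = DistLeIn-weaken X≤s x⇝y
  ... | no  X≰s =
    DistLeIn-weaken (+-cancelˡ-≤ (suc s) Y s (≤-trans (+-monoˡ-≤ Y (≰⇒> X≰s)) X+Y≤)) x⇝y′

  clique⇒DistLeIn : ∀ {W} → IsClique G W → W ⊆ S → x ∈ W → y ∈ W → DistLeIn G S x y 1
  clique⇒DistLeIn {x = x} {y} clique W⊆S x∈W y∈W with x ≟ y
  ... | yes refl = 0 , z≤n , here (W⊆S x∈W)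
  ... | no  x≢y  = 1 , ≤-refl , step (W⊆S x∈W) (clique x y x∈W y∈W x≢y) (here (W⊆S y∈W))

  Interval : Fin n → Fin n → ℕ → Pred (Fin n) 0ℓ
  Interval x y d z = ∃₂ λ a b → a + b ≤ d × DistLe G x z a × DistLe G z y b

  Interval-weaken : d ≤ ℓ → Interval x y d ⊆ᵤ Interval x y ℓ
  Interval-weaken d≤ℓ (a , b , a+b≤d , x⇝z , z⇝y) = a , b , ≤-trans a+b≤d d≤ℓ , x⇝z , z⇝y

  Interval-prefix : a + b ≤ d → DistLe G z y b → Interval x z a ⊆ᵤ Interval x y d
  Interval-prefix {b = b} a+b≤d z⇝y (α , β , α+β≤a , x⇝v , v⇝z) =
    α , β + b , ≤-trans (≤-reflexive (≡-sym (+-assoc α β b))) (≤-trans (+-monoˡ-≤ b α+β≤a) a+b≤d) ,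
    x⇝v , v⇝z ⊙ z⇝y

  Interval-suffix : a + b ≤ d → DistLe G x z a → Interval z y b ⊆ᵤ Interval x y d
  Interval-suffix {a = a} a+b≤d x⇝z (α , β , α+β≤b , z⇝v , v⇝y) =
    a + α , β , ≤-trans (≤-reflexive (+-assoc a α β)) (≤-trans (+-monoʳ-≤ a α+β≤b) a+b≤d) ,
    x⇝z ⊙ z⇝v , v⇝y

  Interval-step : adj G x z ≡ true → Interval z y ℓ ⊆ᵤ Interval x y (suc ℓ)
  Interval-step e (a , b , a+b≤ℓ , z⇝v , v⇝y) = suc a , b , s≤s a+b≤ℓ , DistLe-step e z⇝v , v⇝y

  restrictʷ : Interval x y ℓ ⊆ᵤ (_∈ S) → WalkIn G ⊤ x y ℓ → WalkIn G S x y ℓ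
  restrictʷ I⊆S (here _)       = here (I⊆S (0 , 0 , z≤n , DistLe-refl , DistLe-refl))
  restrictʷ I⊆S p@(step _ e q) =
    step (I⊆S (0 , _ , ≤-refl , DistLe-refl , (_ , ≤-refl , p))) e
         (restrictʷ (I⊆S ∘ Interval-step e) q)

  DistLe⇒DistLeIn : Interval x y d ⊆ᵤ (_∈ S) → DistLe G x y d → DistLeIn G S x y d
  DistLe⇒DistLeIn I⊆S (l , l≤d , p) = l , l≤d , restrictʷ (I⊆S ∘ Interval-weaken l≤d) p

  Interval⊆⇒DistLeIn : Interval x y d ⊆ᵤ (_∈ S) → a + b ≤ d → DistLe G x z a → DistLe G z y b →
                       DistLeIn G S x z a × DistLeIn G S z y b
  Interval⊆⇒DistLeIn I⊆S a+b≤d x⇝z z⇝y =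
    DistLe⇒DistLeIn (I⊆S ∘ Interval-prefix a+b≤d z⇝y) x⇝z ,
    DistLe⇒DistLeIn (I⊆S ∘ Interval-suffix a+b≤d x⇝z) z⇝y

  walkIn? : ∀ S ℓ x y → Dec (WalkIn G S x y ℓ)
  walkIn? S zero x y with x ≟ y | x ∈? S
  ... | yes refl | yes x∈S = yes (here x∈S)
  ... | no  x≢y  | _       = no λ { (here _) → x≢y refl }
  ... | _        | no  x∉S = no λ { (here x∈S) → x∉S x∈S }
  walkIn? S (suc ℓ) x y =
    map′ (λ (x∈S , _ , e , p) → step x∈S e p) (λ { (step x∈S e p) → x∈S , _ , e , p })
         (x ∈? S ×-dec any? λ v → (adj G x v ≟ᵇ true) ×-dec walkIn? S ℓ v y)

  distLeIn? : ∀ S x y d → Dec (DistLeIn G S x y d)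
  distLeIn? S x y d =
    map′ (λ (l , l<1+d , p) → l , ≤-pred l<1+d , p) (λ (l , l≤d , p) → l , s≤s l≤d , p)
         (anyUpTo? (λ l → walkIn? S l x y) (suc d))

  distLe? : ∀ x y d → Dec (DistLe G x y d)
  distLe? = distLeIn? ⊤

  diamLe? : ∀ S s → Dec (DiamLe G S s)
  diamLe? S s = all? λ u → all? λ v → u ∈? S →-dec v ∈? S →-dec distLeIn? S u v s

  interval? : ∀ x y d → Decidable (Interval x y d)
  interval? x y d z =
    map′ (λ (a , a<1+d , x⇝z , z⇝y) →
            a , d ∸ a , ≤-reflexive (m+[n∸m]≡n (≤-pred a<1+d)) , x⇝z , z⇝y)
         (λ (a , b , a+b≤d , x⇝z , z⇝y) →
            a , s≤s (m+n≤o⇒m≤o a a+b≤d) , x⇝z ,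
            DistLeIn-weaken (m+n≤o⇒m≤o∸n b (≤-trans (≤-reflexive (+-comm b a)) a+b≤d)) z⇝y)
         (anyUpTo? (λ a → distLe? x z a ×-dec distLe? z y (d ∸ a)) (suc d))

  seededClubYes? : ∀ W k s → Dec (SeededClubYes G W k s)
  seededClubYes? W k s = anySubset? λ S → W ⊆? S ×-dec k ≤? ∣ S ∣ ×-dec diamLe? S s

  ball : Fin n → ℕ → Subset n
  ball y r = select λ x → distLe? x y r

  ball-suc⊆ : ∀ x r → ball x (suc r) ⊆ ⋃ₛ (ball x r) (λ y → ball y 1)
  ball-suc⊆ x r z∈ball with DistLe-split 1 r (∈-select⁻ _ z∈ball)
  ... | y , z⇝y , y⇝x = ∈-⋃ₛ⁺ (ball x r) (λ y → ball y 1) (∈-select⁺ _ y⇝x) (∈-select⁺ _ z⇝y)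

crossing-routes : ∀ a b a′ b′ {p p′} m m′ → a + b ≤ p → a′ + b′ ≤ p′ →
                  (a + (m + b′)) + (b + (m′ + a′)) ≤ (p + p′) + (m + m′)
crossing-routes a b a′ b′ m m′ a+b≤p a′+b′≤p′ =
  ≤-trans (≤-reflexive (regroup a b a′ b′ m m′)) (+-monoˡ-≤ (m + m′) (+-mono-≤ a+b≤p a′+b′≤p′))
  where
    regroup : ∀ a b a′ b′ m m′ → (a + (m + b′)) + (b + (m′ + a′)) ≡ ((a + b) + (a′ + b′)) + (m + m′)
    regroup = solve-∀

parallel-routes : ∀ a b a′ b′ {p p′} m m′ → a + b ≤ p → a′ + b′ ≤ p′ →
                  (a + (m + a′)) + (b + (m′ + b′)) ≤ (p + p′) + (m + m′)
parallel-routes a b a′ b′ m m′ a+b≤p a′+b′≤p′ =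
  crossing-routes a b b′ a′ m m′ a+b≤p (≤-trans (≤-reflexive (+-comm b′ a′)) a′+b′≤p′)

^-double-step : ∀ k l → (k * k) * k ^ (2 * l + 1) ≡ k ^ (2 * suc l + 1)
^-double-step k l = trans (*-assoc k k _) (cong (k ^_) (exponent l))
  where
    exponent : ∀ l → 2 + (2 * l + 1) ≡ 2 * suc l + 1
    exponent = solve-∀

-- j = ⌊s/2⌋ and suc h₁ = ⌈s/2⌉
radii : ∀ s → 2 ≤ s → ∃₂ λ j h₁ → j + suc h₁ ≡ s × j + j ≤ s × h₁ + h₁ ≤ s × 2 + h₁ ≤ s
radii 0 ()
radii 1 (s≤s ())
radii 2 _ = 1 , 0 , refl , ≤-refl , z≤n , ≤-refl
radii 3 _ = 1 , 1 , refl , s≤s (s≤s z≤n) , s≤s (s≤s z≤n) , ≤-refl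
radii (suc (suc s@(suc (suc _)))) _ with radii s (s≤s (s≤s z≤n))
... | j , h₁ , j+h≡s , j+j≤s , h₁+h₁≤s , 2+h₁≤s =
  suc j , suc h₁ , cong suc (trans (+-suc j (suc h₁)) (cong suc j+h≡s)) ,
  s≤s (≤-trans (≤-reflexive (+-suc j j)) (s≤s j+j≤s)) ,
  s≤s (≤-trans (≤-reflexive (+-suc h₁ h₁)) (s≤s h₁+h₁≤s)) ,
  s≤s (m≤n⇒m≤1+n 2+h₁≤s)

module NoClub {n : ℕ} (G : Graph n) (W : Subset n) (k s : ℕ) .{{_ : NonZero k}}
              (clique : IsClique G W) {w₀ : Fin n} (w₀∈W : w₀ ∈ W)
              (no-club : ¬ SeededClubYes G W k s) where

  open Walks G

  private variable
    u w w′ x : Fin n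

  IsCentre : ℕ → ℕ → Subset n → Fin n → Fin n → Set
  IsCentre j h U w z = DistLe G w z h × (∀ {u} → u ∈ U → DistLe G u z j)

  IsCentre-⊆ : ∀ {j h U U′ w z} → U′ ⊆ U → IsCentre j h U w z → IsCentre j h U′ w z
  IsCentre-⊆ U′⊆U (w⇝z , U⇝z) = w⇝z , U⇝z ∘ U′⊆U

  club-small : ∀ {S} → W ⊆ S → DiamLe G S s → ∣ S ∣ < k
  club-small W⊆S diam = ≰⇒> λ k≤∣S∣ → no-club (_ , W⊆S , k≤∣S∣ , diam)

  module Hull {j h : ℕ} (j+j≤s : j + j ≤ s) (j+h≤s : j + h ≤ s) (c : Fin n → Fin n) (U : Subset n)
              (centres : ∀ {w} → w ∈ W → IsCentre j h U w (c w)) where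

    H : Subset n
    H = select λ x → any? (λ u → u ∈? U ×-dec any? λ w → w ∈? W ×-dec interval? u (c w) j x)
                     ⊎-dec any? (λ w → w ∈? W ×-dec interval? w (c w) h x)

    U-interval⊆H : u ∈ U → w ∈ W → Interval u (c w) j ⊆ᵤ (_∈ H)
    U-interval⊆H u∈U w∈W x∈I = ∈-select⁺ _ (inj₁ (_ , u∈U , _ , w∈W , x∈I))

    W-interval⊆H : w ∈ W → Interval w (c w) h ⊆ᵤ (_∈ H)
    W-interval⊆H w∈W x∈I = ∈-select⁺ _ (inj₂ (_ , w∈W , x∈I))

    W⊆H : W ⊆ H
    W⊆H w∈W = W-interval⊆H w∈W (0 , _ , ≤-refl , DistLe-refl , proj₁ (centres w∈W))

    U⊆H : U ⊆ H
    U⊆H u∈U = U-interval⊆H u∈U w₀∈W (0 , _ , ≤-refl , DistLe-refl , proj₂ (centres w₀∈W) u∈U)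

    U⇝centre : u ∈ U → w ∈ W → DistLeIn G H u (c w) j
    U⇝centre u∈U w∈W = DistLe⇒DistLeIn (U-interval⊆H u∈U w∈W) (proj₂ (centres w∈W) u∈U)

    W⇝centre : w ∈ W → DistLeIn G H w (c w) h
    W⇝centre w∈W = DistLe⇒DistLeIn (W-interval⊆H w∈W) (proj₁ (centres w∈W))

    W⇝W : w ∈ W → w′ ∈ W → DistLeIn G H w w′ 1
    W⇝W = clique⇒DistLeIn clique W⊆H

    data Position (x : Fin n) : Set where
      via-U : ∀ {u w} a b → u ∈ U → w ∈ W → a + b ≤ j →
              DistLeIn G H x u a → DistLeIn G H x (c w) b → Position x
      via-W : ∀ {w} a b → w ∈ W → a + b ≤ h →
              DistLeIn G H x w a → DistLeIn G H x (c w) b → Position x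

    position : x ∈ H → Position x
    position x∈H with ∈-select⁻ _ x∈H
    ... | inj₁ (_ , u∈U , _ , w∈W , _ , _ , a+b≤j , u⇝x , x⇝c) =
      let (u⇝x , x⇝c) = Interval⊆⇒DistLeIn (U-interval⊆H u∈U w∈W) a+b≤j u⇝x x⇝c
      in via-U _ _ u∈U w∈W a+b≤j (u⇝x ˘) x⇝c
    ... | inj₂ (_ , w∈W , _ , _ , a+b≤h , w⇝x , x⇝c) =
      let (w⇝x , x⇝c) = Interval⊆⇒DistLeIn (W-interval⊆H w∈W) a+b≤h w⇝x x⇝c
      in via-W _ _ w∈W a+b≤h (w⇝x ˘) x⇝c

    -- Two vertices of H are joined by two routes through the hubs whose lengths add up to
    -- at most 2s + 1.
    H-diam : ∀ {u₀} → u₀ ∈ U → DiamLe G H s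
    H-diam u₀∈U _ _ x∈H y∈H = route (position x∈H) (position y∈H)
      where
        UU-budget : (j + j) + (j + j) ≤ suc (s + s)
        UU-budget = m≤n⇒m≤1+n (+-mono-≤ j+j≤s j+j≤s)

        UW-budget : (j + h) + (j + (h + 1)) ≤ suc (s + s)
        UW-budget = ≤-trans (≤-reflexive (regroup j h)) (s≤s (+-mono-≤ j+h≤s j+h≤s))
          where
            regroup : ∀ j h → (j + h) + (j + (h + 1)) ≡ suc ((j + h) + (j + h))
            regroup = solve-∀

        WW-budget : (h + h) + (1 + (j + j)) ≤ suc (s + s)
        WW-budget = ≤-trans (≤-reflexive (regroup j h)) (s≤s (+-mono-≤ j+h≤s j+h≤s))
          where
            regroup : ∀ j h → (h + h) + (1 + (j + j)) ≡ suc ((j + h) + (j + h))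
            regroup = solve-∀

        route : ∀ {x y} → Position x → Position y → DistLeIn G H x y s
        route (via-U a b u∈U w∈W ab x⇝u x⇝c) (via-U a′ b′ u′∈U w′∈W a′b′ y⇝u′ y⇝c′) =
          DistLeIn-shorter s (x⇝u ⊙ U⇝centre u∈U w′∈W ⊙ y⇝c′ ˘) (x⇝c ⊙ U⇝centre u′∈U w∈W ˘ ⊙ y⇝u′ ˘)
            (≤-trans (crossing-routes a b a′ b′ j j ab a′b′) UU-budget)
        route (via-U a b u∈U w∈W ab x⇝u x⇝c) (via-W a′ b′ w′∈W a′b′ y⇝w′ y⇝c′) =
          DistLeIn-shorter s (x⇝u ⊙ U⇝centre u∈U w′∈W ⊙ y⇝c′ ˘)
            (x⇝c ⊙ (W⇝centre w∈W ˘ ⊙ W⇝W w∈W w′∈W) ⊙ y⇝w′ ˘)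
            (≤-trans (crossing-routes a b a′ b′ j (h + 1) ab a′b′) UW-budget)
        route x@(via-W _ _ _ _ _ _) y@(via-U _ _ _ _ _ _ _) = route y x ˘
        route (via-W a b w∈W ab x⇝w x⇝c) (via-W a′ b′ w′∈W a′b′ y⇝w′ y⇝c′) =
          DistLeIn-shorter s (x⇝w ⊙ W⇝W w∈W w′∈W ⊙ y⇝w′ ˘)
            (x⇝c ⊙ (U⇝centre u₀∈U w∈W ˘ ⊙ U⇝centre u₀∈U w′∈W) ⊙ y⇝c′ ˘)
            (≤-trans (parallel-routes a b a′ b′ 1 (j + j) ab a′b′) WW-budget)

    U-small : ∣ U ∣ < k
    U-small with nonempty? U
    ... | yes (_ , u₀∈U) = ≤-<-trans (p⊆q⇒∣p∣≤∣q∣ U⊆H) (club-small W⊆H (H-diam u₀∈U))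
    ... | no  U-empty    = subst (_< k) (≡-sym (Empty⇒∣p∣≡0 U-empty)) (>-nonZero⁻¹ k)

  centred-small : ∀ {j h} → j + j ≤ s → j + h ≤ s → (c : Fin n → Fin n) {U : Subset n} →
                  (∀ {w} → w ∈ W → IsCentre j h U w (c w)) → ∣ U ∣ < k
  centred-small j+j≤s j+h≤s c {U} = Hull.U-small j+j≤s j+h≤s c U

  ball-small : ∀ {y r t} → r + r ≤ s → r + t ≤ s → (∀ {w} → w ∈ W → DistLe G w y t) →
               ∣ ball y r ∣ < k
  ball-small {y} r+r≤s r+t≤s W⇝y =
    centred-small r+r≤s r+t≤s (λ _ → y) λ w∈W → W⇝y w∈W , ∈-select⁻ _

  -- Radius ⌈s/2⌉ is too large for ball-small when s is odd, hence the detour through radius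
  -- ⌈s/2⌉ − 1.
  candidates-small : ∀ {h₁} → h₁ + h₁ ≤ s → 2 + h₁ ≤ s → w ∈ W → ∣ ball w (suc h₁) ∣ < k * k
  candidates-small {w} {h₁} h₁+h₁≤s 2+h₁≤s w∈W =
    ≤-<-trans (p⊆q⇒∣p∣≤∣q∣ (ball-suc⊆ w h₁))
              (∣⋃ₛ∣< (ball w h₁) (λ y → ball y 1) inner-small outer-small)
    where
      W⇝w : ∀ {w′} → w′ ∈ W → DistLe G w′ w 1
      W⇝w w′∈W = clique⇒DistLeIn clique (λ _ → ∈⊤) w′∈W w∈W

      inner-small : ∣ ball w h₁ ∣ < k
      inner-small = ball-small h₁+h₁≤s (≤-trans (≤-reflexive (+-comm h₁ 1)) (<⇒≤ 2+h₁≤s)) W⇝w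

      outer-small : ∀ {y} → y ∈ ball w h₁ → ∣ ball y 1 ∣ < k
      outer-small y∈ball =
        ball-small (m+n≤o⇒m≤o 2 2+h₁≤s) 2+h₁≤s λ w′∈W → W⇝w w′∈W ⊙ ∈-select⁻ _ y∈ball ˘

  module _ {j h₁ : ℕ} (j+h≡s : j + suc h₁ ≡ s) (j+j≤s : j + j ≤ s)
           (h₁+h₁≤s : h₁ + h₁ ≤ s) (2+h₁≤s : 2 + h₁ ≤ s)
           (W-near : ∀ u {w} → w ∈ W → DistLe G u w s) where

    centres-bound : ∀ (L : List (Fin n)) → All (_∈ W) L → (c : Fin n → Fin n) (U : Subset n) →
                    (∀ {w} → w ∈ W → w ∉ₗ L → IsCentre j (suc h₁) U w (c w)) →
                    ∣ U ∣ < k ^ (2 * length L + 1)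
    centres-bound [] [] c U centres =
      subst (∣ U ∣ <_) (≡-sym (*-identityʳ k))
        (centred-small j+j≤s (≤-reflexive j+h≡s) c λ w∈W → centres w∈W λ ())
    centres-bound (w ∷ L) (w∈W ∷ L⊆W) c U centres =
      subst (∣ U ∣ <_) (^-double-step k (length L))
        (≤-<-trans (p⊆q⇒∣p∣≤∣q∣ U⊆⋃)
                   (∣⋃ₛ∣< (ball w h) fibre {{m^n≢0 k (2 * length L + 1)}}
                          (candidates-small h₁+h₁≤s 2+h₁≤s w∈W) fibre-small))
      where
        h = suc h₁

        fibre : Fin n → Subset n
        fibre z = U ∩ ball z j

        U⊆⋃ : U ⊆ ⋃ₛ (ball w h) fibre
        U⊆⋃ {u} u∈U with DistLe-split j h (subst (DistLe G u w) (≡-sym j+h≡s) (W-near u w∈W))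
        ... | z , u⇝z , z⇝w =
          ∈-⋃ₛ⁺ (ball w h) fibre (∈-select⁺ _ z⇝w) (x∈p∩q⁺ (u∈U , ∈-select⁺ _ u⇝z))

        fibre-small : ∀ {z} → z ∈ ball w h → ∣ fibre z ∣ < k ^ (2 * length L + 1)
        fibre-small {z} z∈ball = centres-bound L L⊆W (updateAt c w (const z)) (fibre z) centres′
          where
            centres′ : ∀ {w′} → w′ ∈ W → w′ ∉ₗ L →
                       IsCentre j h (fibre z) w′ (updateAt c w (const z) w′)
            centres′ {w′} w′∈W w′∉L with w′ ≟ w
            ... | yes refl = subst (IsCentre j h (fibre z) w) (≡-sym (updateAt-updates w c))
                               (∈-select⁻ _ z∈ball ˘ , ∈-select⁻ _ ∘ proj₂ ∘ x∈p∩q⁻ U _)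
            ... | no  w′≢w =
              subst (IsCentre j h (fibre z) w′) (≡-sym (updateAt-minimal w′ w c w′≢w))
                (IsCentre-⊆ (p∩q⊆p U _) (centres w′∈W λ { (here w′≡w)  → w′≢w w′≡w
                                                        ; (there w′∈L) → w′∉L w′∈L }))

  vertices-bound : 2 ≤ s → (∀ u {w} → w ∈ W → DistLe G u w s) →
                   ∀ U → ∣ U ∣ < k ^ (2 * ∣ W ∣ + 1)
  vertices-bound 2≤s W-near U =
    let j , h₁ , j+h≡s , j+j≤s , h₁+h₁≤s , 2+h₁≤s = radii s 2≤s
    in subst (λ l → ∣ U ∣ < k ^ (2 * l + 1)) (length-elements W)
         (centres-bound j+h≡s j+j≤s h₁+h₁≤s 2+h₁≤s W-near (elements W) (elements⊆ W) id U
            λ w∈W w∉W → contradiction (∈-elements⁺ w∈W) w∉W)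

lemma12 : ∀ {n : ℕ} (G : Graph n) (W : Subset n) (k s : ℕ)
    → 2 ≤ s
    → 1 ≤ k
    → IsClique G W
    → ∣ W ∣ < k
    → (∀ u w → w ∈ W → DistLe G u w s)
    → Σ (Subset n) (λ T → (∀ u → u ∈ T → InNs G W s u) × k ^ (2 * ∣ W ∣ + 1) ≤ ∣ T ∣)
    → SeededClubYes G W k s
lemma12 G W k s 2≤s 1≤k clique _ W-near (T , T⊆Nₛ , big) with Walks.seededClubYes? G W k s
... | yes club   = club
... | no no-club = contradiction big (<⇒≱ ∣T∣<)
  where
    instance _ = >-nonZero 1≤k

    ∣T∣< : ∣ T ∣ < k ^ (2 * ∣ W ∣ + 1)
    ∣T∣< with nonempty? T
    ... | no  T-empty   =
      subst (_< k ^ (2 * ∣ W ∣ + 1)) (≡-sym (Empty⇒∣p∣≡0 T-empty)) (m^n>0 k (2 * ∣ W ∣ + 1))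
    ... | yes (t , t∈T) =
      let (_ , w₀∈W , _) , _ = T⊆Nₛ t t∈T
      in NoClub.vertices-bound G W k s clique w₀∈W no-club 2≤s (λ u → W-near u _) T
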